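{- For every $k\in\mathbb{N}$ and every $i,j\in\{0,1,\dots,2^k-1\}$, $\mathrm{lcis}(\alpha_k^0\cdots\alpha_k^i,\ \beta_k^0\cdots\beta_k^j) = i+j+2^k$.
   Context: $\mathrm{lcis}(X,Y)$ denotes the length of a longest strictly increasing common subsequence of integer sequences $X,Y$. For $A=\langle a_0,\dots,a_{n-1}\rangle$ let $\mathrm{inflate}(A)=\langle 2a_0-1,2a_0,\dots,2a_{n-1}-1,2a_{n-1}\rangle$; $\circ$ denotes concatenation. Sequences $A_k=\alpha_k^0\cdots\alpha_k^{2^k-1}$ and $B_k=\beta_k^0\cdots\beta_k^{2^k-1}$ (concatenations of $2^k$ blocks) are defined inductively: $A_0=B_0=\langle 1\rangle$. Given $A_k,B_k$, let $s_k$ be the largest element occurring in them, and for $i\in\{0,\dots,2^k-1\}$ set $\alpha_{k+1}^{2i}=\mathrm{inflate}(\alpha_k^i)\circ\langle 2s_k+2\rangle$, $\alpha_{k+1}^{2i+1}=\langle 2s_k+1,2s_k+3\rangle$, $\beta_{k+1}^{2i}=\mathrm{inflate}(\beta_k^i)\circ\langle 2s_k+1\rangle$, $\beta_{k+1}^{2i+1}=\langle 2s_k+2,2s_k+3\rangle$. -}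

module Defs where

open import Data.Nat using (ℕ; zero; suc; _+_; _*_; _∸_; _<_; _≤_; _⊔_)
open import Data.List using (List; []; _∷_; _++_; concat; map; take; length; foldr)
open import Data.List.Relation.Binary.Sublist.Propositional using (_⊆_)
open import Data.List.Relation.Unary.Linked using (Linked)
open import Data.Product using (Σ; _×_; _,_)

-- Integer sequences are lists of naturals: every element occurring in the
-- construction is a positive integer (≥ 1), so ℕ loses nothing.

inflate : List ℕ → List ℕ
inflate []       = []
inflate (a ∷ as) = (2 * a ∸ 1) ∷ (2 * a) ∷ inflate as

maxList : List ℕ → ℕ
maxList = foldr _⊔_ 0

stepA : ℕ → List (List ℕ) → List (List ℕ)
stepA s []       = []
stepA s (α ∷ αs) = (inflate α ++ (2 * s + 2) ∷ []) ∷ ((2 * s + 1) ∷ (2 * s + 3) ∷ []) ∷ stepA s αs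

stepB : ℕ → List (List ℕ) → List (List ℕ)
stepB s []       = []
stepB s (β ∷ βs) = (inflate β ++ (2 * s + 1) ∷ []) ∷ ((2 * s + 2) ∷ (2 * s + 3) ∷ []) ∷ stepB s βs

-- blocks k = (α_k^0 … α_k^{2^k-1} , β_k^0 … β_k^{2^k-1})
blocks : ℕ → List (List ℕ) × List (List ℕ)
blocks zero = ((1 ∷ []) ∷ []) , ((1 ∷ []) ∷ [])
blocks (suc k) with blocks k
... | as , bs =
  let s = maxList (concat as) ⊔ maxList (concat bs) in
  stepA s as , stepB s bs

αs : ℕ → List (List ℕ)
αs k with blocks k
... | as , _ = as

βs : ℕ → List (List ℕ)
βs k with blocks k
... | _ , bs = bs

A : ℕ → List ℕ
A k = concat (αs k)

B : ℕ → List ℕ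
B k = concat (βs k)

prefixA : ℕ → ℕ → List ℕ
prefixA k i = concat (take (suc i) (αs k))

prefixB : ℕ → ℕ → List ℕ
prefixB k j = concat (take (suc j) (βs k))

IsCIS : List ℕ → List ℕ → List ℕ → Set
IsCIS X Y Z = Linked _<_ Z × Z ⊆ X × Z ⊆ Y

LcisIs : List ℕ → List ℕ → ℕ → Set
LcisIs X Y n =
  Σ (List ℕ) (λ Z → IsCIS X Y Z × length Z ≡ n) ×
  (∀ Z → IsCIS X Y Z → length Z ≤ n)
  where open import Relation.Binary.PropositionalEquality using (_≡_)

module Submission where

-- Block 2i of step k+1 is the inflation of block i of step k
-- followed by one new entry, block 2i+1 consists of two new entries, and the new entries
-- 2s+1, 2s+2, 2s+3 exceed every inflated entry.  An increasing common subsequence of the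
-- prefixes ending at blocks 2t+b and 2u+c therefore splits into a low part inside the
-- inflations of the old prefixes ending at blocks t and u, which halving (rounding up) turns
-- into an old increasing common subsequence of at least half its length, and a high part,
-- taken from the new entries of the last b+1 resp. c+1 blocks, of length at most b + c.
-- Conversely, inflating an optimal old subsequence and appending b + c suitable new
-- entries attains 2(t + u + 2^k) + b + c.

open import Defs
open import Data.Nat using (ℕ; _+_; _<_; _^_)
open import Data.Nat.Base using (zero; suc; _*_; _∸_; _≤_; _⊔_; _/_; _%_; ⌈_/2⌉; z≤n; s≤s; z<s; s≤s⁻¹)
open import Data.Nat.Properties
open import Data.Nat.DivMod using (m≡m%n+[m/n]*n; m%n<n)
open import Data.Nat.Tactic.RingSolver using (solve-∀)
open import Data.List.Base using (List; []; _∷_; _++_; concat; map; take; length)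
open import Data.List.Properties using (++-assoc; ++-identityʳ; length-++)
open import Data.List.Relation.Binary.Sublist.Propositional
  using (_⊆_; []; _∷_; _∷ʳ_; ⊆-refl; ⊆-trans; minimum)
open import Data.List.Relation.Binary.Sublist.Propositional.Properties
  using (++⁺; ++⁺ˡ; ++⁺ʳ; ∷ˡ⁻; length-mono-≤; All-resp-⊆)
open import Data.List.Relation.Unary.All as All using (All; []; _∷_)
import Data.List.Relation.Unary.All.Properties as All
open import Data.List.Relation.Unary.AllPairs using (AllPairs; []; _∷_)
import Data.List.Relation.Unary.AllPairs.Properties as AllPairs
open import Data.List.Relation.Unary.Linked using ([-])
open import Data.List.Relation.Unary.Linked.Properties using (AllPairs⇒Linked; Linked⇒AllPairs)
open import Data.Product using (∃; ∃₂; _×_; _,_; proj₁; proj₂)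
open import Data.Empty using (⊥-elim)
open import Relation.Nullary using (¬_; yes; no)
open import Relation.Binary.PropositionalEquality

private
  variable
    x y s : ℕ
    xs ys zs us vs ls hs : List ℕ

prefix : List (List ℕ) → ℕ → List ℕ
prefix xss i = concat (take (suc i) xss)

All-prefix : ∀ {P : ℕ → Set} xss {i} → All P (concat xss) → All P (prefix xss i)
All-prefix xss {i} p = All.concat⁺ (All.take⁺ (suc i) (All.concat⁻ {xss = xss} p))

parity : ∀ m → ∃₂ λ t b → b ≤ 1 × m ≡ 2 * t + b
parity m = m / 2 , m % 2 , s≤s⁻¹ (m%n<n m 2) , (begin
  m                 ≡⟨ m≡m%n+[m/n]*n m 2 ⟩
  m % 2 + m / 2 * 2 ≡⟨ +-comm (m % 2) _ ⟩
  m / 2 * 2 + m % 2 ≡⟨ cong (_+ m % 2) (*-comm (m / 2) 2) ⟩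
  2 * (m / 2) + m % 2 ∎)
  where open ≡-Reasoning

2*t+b<2*n⇒t<n : ∀ {t b n} → 2 * t + b < 2 * n → t < n
2*t+b<2*n⇒t<n {t} {b} {n} lt = *-cancelˡ-< 2 t n (≤-<-trans (m≤m+n (2 * t) b) lt)

regroup : ∀ t u n b c → 2 * (t + u + n) + (b + c) ≡ 2 * t + b + (2 * u + c) + 2 * n
regroup = solve-∀

*2<*2∸1 : x < y → 2 * x < 2 * y ∸ 1
*2<*2∸1 {x} {suc y} (s≤s x≤y) =
  subst (2 * x <_) (sym (cong (_∸ 1) (*-suc 2 y))) (s≤s (*-monoʳ-≤ 2 x≤y))

⌈2*n/2⌉≡n : ∀ n → ⌈ 2 * n /2⌉ ≡ n
⌈2*n/2⌉≡n zero = refl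
⌈2*n/2⌉≡n (suc n) = trans (cong ⌈_/2⌉ (*-suc 2 n)) (cong suc (⌈2*n/2⌉≡n n))

⌈1+2*n/2⌉≡1+n : ∀ n → ⌈ suc (2 * n) /2⌉ ≡ suc n
⌈1+2*n/2⌉≡1+n zero = refl
⌈1+2*n/2⌉≡1+n (suc n) = trans (cong (λ m → ⌈ suc m /2⌉) (*-suc 2 n)) (cong suc (⌈1+2*n/2⌉≡1+n n))

⌈2*n∸1/2⌉≡n : ∀ n → ⌈ 2 * n ∸ 1 /2⌉ ≡ n
⌈2*n∸1/2⌉≡n zero = refl
⌈2*n∸1/2⌉≡n (suc n) = trans (cong (λ m → ⌈ m ∸ 1 /2⌉) (*-suc 2 n)) (⌈1+2*n/2⌉≡1+n n)

2*m<n⇒m<⌈n/2⌉ : 2 * x < y → x < ⌈ y /2⌉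
2*m<n⇒m<⌈n/2⌉ {x} {y} lt = subst (_≤ ⌈ y /2⌉) (⌈1+2*n/2⌉≡1+n x) (⌈n/2⌉-mono lt)

AllPairs-resp-⊆ : ∀ {R : ℕ → ℕ → Set} → xs ⊆ ys → AllPairs R ys → AllPairs R xs
AllPairs-resp-⊆ []         []       = []
AllPairs-resp-⊆ (_ ∷ʳ p)   (_ ∷ rs) = AllPairs-resp-⊆ p rs
AllPairs-resp-⊆ (refl ∷ p) (r ∷ rs) = All-resp-⊆ p r ∷ AllPairs-resp-⊆ p rs

∷⊈[] : ¬ (x ∷ xs ⊆ [])
∷⊈[] ()

⊆-++-split : ∀ us → zs ⊆ us ++ vs → ∃₂ λ zs₁ zs₂ → zs ≡ zs₁ ++ zs₂ × zs₁ ⊆ us × zs₂ ⊆ vs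
⊆-++-split []       p          = [] , _ , refl , [] , p
⊆-++-split (u ∷ us) (_ ∷ʳ p)   with ⊆-++-split us p
... | zs₁ , zs₂ , refl , p₁ , p₂ = zs₁ , zs₂ , refl , u ∷ʳ p₁ , p₂
⊆-++-split (u ∷ us) (refl ∷ p) with ⊆-++-split us p
... | zs₁ , zs₂ , refl , p₁ , p₂ = u ∷ zs₁ , zs₂ , refl , refl ∷ p₁ , p₂

∷-⊆-++⁻ʳ : All (x ≢_) us → x ∷ xs ⊆ us ++ vs → x ∷ xs ⊆ vs
∷-⊆-++⁻ʳ []            p          = p
∷-⊆-++⁻ʳ (_ ∷ x∉us)    (_ ∷ʳ p)   = ∷-⊆-++⁻ʳ x∉us p
∷-⊆-++⁻ʳ (x≢u ∷ _)     (refl ∷ _) = ⊥-elim (x≢u refl)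

module _ {L : ℕ} where

  above-⊆-++⁻ʳ : All (_≤ L) us → All (L <_) zs → zs ⊆ us ++ vs → zs ⊆ vs
  above-⊆-++⁻ʳ _    []          _ = minimum _
  above-⊆-++⁻ʳ us≤L (L<z ∷ _)   p = ∷-⊆-++⁻ʳ (All.map (λ u≤L → >⇒≢ (≤-<-trans u≤L L<z)) us≤L) p

  ⊆-++-split-below : ∀ us ls → All (_≤ L) us → All (L <_) hs → ls ++ hs ⊆ us ++ vs →
    ∃₂ λ ls₁ ls₂ → ls ≡ ls₁ ++ ls₂ × ls₁ ⊆ us × ls₂ ++ hs ⊆ vs
  ⊆-++-split-below us       []       us≤L hs>L p =
    [] , [] , refl , minimum us , above-⊆-++⁻ʳ us≤L hs>L p
  ⊆-++-split-below []       (l ∷ ls) _    _    p =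
    [] , l ∷ ls , refl , [] , p
  ⊆-++-split-below (u ∷ us) (l ∷ ls) (_ ∷ us≤L) hs>L (_ ∷ʳ p)
    with ⊆-++-split-below us (l ∷ ls) us≤L hs>L p
  ... | ls₁ , ls₂ , eq , p₁ , p₂ = ls₁ , ls₂ , eq , u ∷ʳ p₁ , p₂
  ⊆-++-split-below (u ∷ us) (l ∷ ls) (_ ∷ us≤L) hs>L (refl ∷ p)
    with ⊆-++-split-below us ls us≤L hs>L p
  ... | ls₁ , ls₂ , eq , p₁ , p₂ = l ∷ ls₁ , ls₂ , cong (l ∷_) eq , refl ∷ p₁ , p₂

  split-increasing : ∀ zs → AllPairs _<_ zs → ∃₂ λ ls hs → zs ≡ ls ++ hs × All (_≤ L) ls × All (L <_) hs
  split-increasing []       _ = [] , [] , refl , [] , []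
  split-increasing (z ∷ zs) (z<zs ∷ sorted) with z ≤? L
  ... | no z≰L = [] , z ∷ zs , refl , [] , (≰⇒> z≰L ∷ All.map (<-trans (≰⇒> z≰L)) z<zs)
  ... | yes z≤L with split-increasing zs sorted
  ...   | ls , hs , refl , ls≤L , hs>L = z ∷ ls , hs , refl , z≤L ∷ ls≤L , hs>L

length-≤-width : ∀ c m → AllPairs _<_ zs → All (λ z → c < z × z ≤ c + m) zs → length zs ≤ m
length-≤-width c m       []              []                 = z≤n
length-≤-width c zero    (_ ∷ _)         ((c<z , z≤c+0) ∷ _) =
  ⊥-elim (<⇒≱ c<z (≤-trans z≤c+0 (≤-reflexive (+-identityʳ c))))
length-≤-width c (suc m) (z<zs ∷ sorted) ((c<z , _) ∷ range) =
  s≤s (length-≤-width (suc c) m sorted (All.zipWith shift (z<zs , range)))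
  where
  shift : ∀ {w} → _ < w × (c < w × w ≤ c + suc m) → suc c < w × w ≤ suc c + m
  shift (z<w , _ , w≤) = ≤-<-trans c<z z<w , ≤-trans w≤ (≤-reflexive (+-suc c m))

length-increasing-⊆-inversion : ¬ x < y → AllPairs _<_ zs → zs ⊆ x ∷ y ∷ ys → length zs ≤ suc (length ys)
length-increasing-⊆-inversion x≮y _                   (_ ∷ʳ p)          = length-mono-≤ p
length-increasing-⊆-inversion x≮y _                   (refl ∷ (_ ∷ʳ p)) = s≤s (length-mono-≤ p)
length-increasing-⊆-inversion x≮y ((x<y ∷ _) ∷ _)     (refl ∷ (refl ∷ _)) = ⊥-elim (x≮y x<y)

All-≤-maxList : ∀ xs → All (_≤ maxList xs) xs
All-≤-maxList []       = []
All-≤-maxList (x ∷ xs) = m≤m⊔n x _ ∷ All.map (λ p → ≤-trans p (m≤n⊔m x _)) (All-≤-maxList xs)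

All-≤-maxList-⊔ˡ : ∀ xs ys → All (_≤ maxList xs ⊔ maxList ys) xs
All-≤-maxList-⊔ˡ xs ys = All.map (λ p → ≤-trans p (m≤m⊔n _ _)) (All-≤-maxList xs)

All-≤-maxList-⊔ʳ : ∀ xs ys → All (_≤ maxList xs ⊔ maxList ys) ys
All-≤-maxList-⊔ʳ xs ys = All.map (λ p → ≤-trans p (m≤n⊔m _ _)) (All-≤-maxList ys)

inflate-++ : ∀ xs ys → inflate (xs ++ ys) ≡ inflate xs ++ inflate ys
inflate-++ []       ys = refl
inflate-++ (x ∷ xs) ys = cong (λ r → 2 * x ∸ 1 ∷ 2 * x ∷ r) (inflate-++ xs ys)

inflate⁺ : xs ⊆ ys → inflate xs ⊆ inflate ys
inflate⁺ []         = []
inflate⁺ (y ∷ʳ p)   = _ ∷ʳ (_ ∷ʳ inflate⁺ p)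
inflate⁺ (refl ∷ p) = refl ∷ (refl ∷ inflate⁺ p)

length-inflate : ∀ xs → length (inflate xs) ≡ 2 * length xs
length-inflate []       = refl
length-inflate (x ∷ xs) = trans (cong (2 +_) (length-inflate xs)) (sym (*-suc 2 (length xs)))

All-inflate : ∀ {P Q : ℕ → Set} → (∀ {a} → P a → Q (2 * a ∸ 1) × Q (2 * a)) →
              All P xs → All Q (inflate xs)
All-inflate f []         = []
All-inflate f (pa ∷ pas) = proj₁ (f pa) ∷ proj₂ (f pa) ∷ All-inflate f pas

All-≤-inflate : All (_≤ s) xs → All (_≤ 2 * s) (inflate xs)
All-≤-inflate = All-inflate λ a≤s → ≤-trans (m∸n≤m _ 1) (*-monoʳ-≤ 2 a≤s) , *-monoʳ-≤ 2 a≤s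

All-<-inflate : All (x <_) xs → All (2 * x <_) (inflate xs)
All-<-inflate = All-inflate λ x<a → *2<*2∸1 x<a , *-monoʳ-< 2 x<a

inflate-increasing : All (0 <_) xs → AllPairs _<_ xs → AllPairs _<_ (inflate xs)
inflate-increasing []            []              = []
inflate-increasing {x ∷ xs} (0<x ∷ pos) (x<xs ∷ sorted) =
  (odd<even ∷ All.map (<-trans odd<even) later) ∷ later ∷ inflate-increasing pos sorted
  where
  odd<even : 2 * x ∸ 1 < 2 * x
  odd<even = ∸-monoʳ-< z<s (*-monoʳ-< 2 0<x)
  later : All (2 * x <_) (inflate xs)
  later = All-<-inflate x<xs

-- The two entries 2a-1, 2a that inflate makes of a both halve (rounding up) to a, and are merged.
deflate : List ℕ → List ℕ
deflate []            = []
deflate (z ∷ [])      = ⌈ z /2⌉ ∷ []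
deflate (z ∷ rest@(z′ ∷ zs)) with ⌈ z /2⌉ ≟ ⌈ z′ /2⌉ | deflate zs | deflate rest
... | yes _ | merged | _      = ⌈ z /2⌉ ∷ merged
... | no  _ | _      | single = ⌈ z /2⌉ ∷ single

deflate-twin : ∀ {z z′} → ⌈ z /2⌉ ≡ x → ⌈ z′ /2⌉ ≡ x → deflate (z ∷ z′ ∷ zs) ≡ x ∷ deflate zs
deflate-twin {z = z} {z′} refl eq′ with ⌈ z /2⌉ ≟ ⌈ z′ /2⌉
... | yes _ = refl
... | no ne = ⊥-elim (ne (sym eq′))

deflate-head : ∀ {z} → ⌈ z /2⌉ ≡ x → All (2 * x <_) zs → deflate (z ∷ zs) ≡ x ∷ deflate zs
deflate-head refl [] = refl
deflate-head {zs = z′ ∷ _} {z = z} refl (lt ∷ _) with ⌈ z /2⌉ ≟ ⌈ z′ /2⌉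
... | yes eq = ⊥-elim (<⇒≢ (2*m<n⇒m<⌈n/2⌉ lt) eq)
... | no  _  = refl

deflate-⊆-map : ∀ zs → deflate zs ⊆ map ⌈_/2⌉ zs
deflate-⊆-map []            = []
deflate-⊆-map (z ∷ [])      = refl ∷ []
deflate-⊆-map (z ∷ rest@(z′ ∷ zs)) with ⌈ z /2⌉ ≟ ⌈ z′ /2⌉ | deflate-⊆-map zs | deflate-⊆-map rest
... | yes _ | merged | _      = refl ∷ (_ ∷ʳ merged)
... | no  _ | _      | single = refl ∷ single

All-deflate : ∀ {P : ℕ → Set} → All (λ z → P ⌈ z /2⌉) zs → All P (deflate zs)
All-deflate {zs = zs} ps = All-resp-⊆ (deflate-⊆-map zs) (All.map⁺ ps)

length-deflate : ∀ zs → length zs ≤ 2 * length (deflate zs)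
length-deflate []                   = z≤n
length-deflate (z ∷ [])             = s≤s z≤n
length-deflate (z ∷ rest@(z′ ∷ zs)) with ⌈ z /2⌉ ≟ ⌈ z′ /2⌉ | length-deflate zs | length-deflate rest
... | yes _ | merged | _      = ≤-trans (s≤s (s≤s merged)) (≤-reflexive (sym (*-suc 2 _)))
... | no  _ | _      | single = ≤-trans (s≤s (≤-trans single (n≤1+n _))) (≤-reflexive (sym (*-suc 2 _)))

deflate-increasing : AllPairs _<_ zs → AllPairs _<_ (deflate zs)
deflate-increasing []        = []
deflate-increasing ([] ∷ []) = [] ∷ []
deflate-increasing {z ∷ z′ ∷ zs} ((z<z′ ∷ _) ∷ rest@(z′<zs ∷ sorted))
  with ⌈ z /2⌉ ≟ ⌈ z′ /2⌉ | deflate-increasing sorted | deflate-increasing rest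
... | yes _ | merged | _      =
  All-deflate (All.map (λ z′<w → ⌈n/2⌉-mono (≤-trans (s≤s z<z′) z′<w)) z′<zs) ∷ merged
... | no ne | _      | single =
  All-deflate (h<h′ ∷ All.map (λ z′<w → <-≤-trans h<h′ (⌈n/2⌉-mono (<⇒≤ z′<w))) z′<zs) ∷ single
  where
  h<h′ : ⌈ z /2⌉ < ⌈ z′ /2⌉
  h<h′ = ≤∧≢⇒< (⌈n/2⌉-mono (<⇒≤ z<z′)) ne

deflate-⊆ : ∀ xs → AllPairs _<_ zs → zs ⊆ inflate xs → deflate zs ⊆ xs
deflate-⊆ []       _                  []                  = []
deflate-⊆ (x ∷ xs) sorted             (_ ∷ʳ (_ ∷ʳ p))     = x ∷ʳ deflate-⊆ xs sorted p
deflate-⊆ {_ ∷ zs} (x ∷ xs) (2x<zs ∷ sorted) (_ ∷ʳ (refl ∷ p)) =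
  subst (_⊆ x ∷ xs) (sym (deflate-head {zs = zs} (⌈2*n/2⌉≡n x) 2x<zs))
    (refl ∷ deflate-⊆ xs sorted p)
deflate-⊆ {_ ∷ _ ∷ zs} (x ∷ xs) (_ ∷ (_ ∷ sorted)) (refl ∷ (refl ∷ p)) =
  subst (_⊆ x ∷ xs) (sym (deflate-twin {zs = zs} (⌈2*n∸1/2⌉≡n x) (⌈2*n/2⌉≡n x)))
    (refl ∷ deflate-⊆ xs sorted p)
deflate-⊆ (x ∷ xs) (odd<zs ∷ sorted)  (refl ∷ (_ ∷ʳ p))   = odd-start odd<zs sorted p
  where
  odd-start : All (2 * x ∸ 1 <_) zs → AllPairs _<_ zs → zs ⊆ inflate xs →
              deflate (2 * x ∸ 1 ∷ zs) ⊆ x ∷ xs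
  odd-start [] [] q = ⌈2*n∸1/2⌉≡n x ∷ minimum xs
  odd-start {w ∷ zs} (odd<w ∷ _) (w<zs ∷ sorted) q with w ≟ 2 * x
  ... | yes refl = subst (_⊆ x ∷ xs) (sym (deflate-twin {zs = zs} (⌈2*n∸1/2⌉≡n x) (⌈2*n/2⌉≡n x)))
                     (refl ∷ deflate-⊆ xs sorted (∷ˡ⁻ q))
  ... | no w≢2x  = subst (_⊆ x ∷ xs)
                     (sym (deflate-head {zs = w ∷ zs} (⌈2*n∸1/2⌉≡n x) (2x<w ∷ All.map (<-trans 2x<w) w<zs)))
                     (refl ∷ deflate-⊆ xs (w<zs ∷ sorted) q)
    where
    2x<w : 2 * x < w
    2x<w = ≤∧≢⇒< (≤-trans (m≤n+m∸n (2 * x) 1) odd<w) (≢-sym w≢2x)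

deflate-IsCIS : AllPairs _<_ zs → zs ⊆ inflate xs → zs ⊆ inflate ys → IsCIS xs ys (deflate zs)
deflate-IsCIS {xs = xs} {ys} sorted p q =
  AllPairs⇒Linked (deflate-increasing sorted) , deflate-⊆ xs sorted p , deflate-⊆ ys sorted q

module Expansion (e o₁ o₂ : ℕ) where

  expand : List (List ℕ) → List (List ℕ)
  expand []       = []
  expand (α ∷ as) = (inflate α ++ e ∷ []) ∷ (o₁ ∷ o₂ ∷ []) ∷ expand as

  expandPrefix : List (List ℕ) → ℕ → List ℕ
  afterBlock   : List (List ℕ) → ℕ → List ℕ

  expandPrefix []       _ = []
  expandPrefix (α ∷ as) i = inflate α ++ afterBlock as i

  afterBlock as zero          = e ∷ []
  afterBlock as (suc zero)    = e ∷ o₁ ∷ o₂ ∷ []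
  afterBlock as (suc (suc i)) = e ∷ o₁ ∷ o₂ ∷ expandPrefix as i

  -- The new entries of the blocks 2t, …, 2t+b of expand as, for any t.
  highs : ℕ → List ℕ
  highs zero          = e ∷ []
  highs (suc zero)    = e ∷ o₁ ∷ o₂ ∷ []
  highs (suc (suc b)) = e ∷ o₁ ∷ o₂ ∷ highs b

  prefix-expand : ∀ as i → prefix (expand as) i ≡ expandPrefix as i
  prefix-expand []       i             = refl
  prefix-expand (α ∷ as) zero          = ++-identityʳ _
  prefix-expand (α ∷ as) (suc zero)    = ++-assoc (inflate α) (e ∷ []) (o₁ ∷ o₂ ∷ [])
  prefix-expand (α ∷ as) (suc (suc i)) =
    trans (++-assoc (inflate α) (e ∷ []) _)
      (cong (λ r → inflate α ++ e ∷ o₁ ∷ o₂ ∷ r) (prefix-expand as i))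

  length-expand : ∀ as → length (expand as) ≡ 2 * length as
  length-expand []       = refl
  length-expand (α ∷ as) = trans (cong (2 +_) (length-expand as)) (sym (*-suc 2 (length as)))

  module _ {P : ℕ → Set} (pe : P e) (po₁ : P o₁) (po₂ : P o₂) where

    All-expand : ∀ {as} → All (λ α → All P (inflate α)) as → All P (concat (expand as))
    All-expand []         = []
    All-expand (pα ∷ pas) = All.++⁺ (All.++⁺ pα (pe ∷ [])) (po₁ ∷ po₂ ∷ All-expand pas)

    All-highs : ∀ b → All P (highs b)
    All-highs zero          = pe ∷ []
    All-highs (suc zero)    = pe ∷ po₁ ∷ po₂ ∷ []
    All-highs (suc (suc b)) = pe ∷ po₁ ∷ po₂ ∷ All-highs b

  inflate-prefix-⊆ : ∀ as i b → b ≤ 1 → i < length as →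
                     inflate (prefix as i) ++ highs b ⊆ expandPrefix as (2 * i + b)
  inflate-prefix-⊆ (α ∷ as) zero b b≤1 _ =
    subst (λ β → inflate β ++ highs b ⊆ inflate α ++ afterBlock as b) (sym (++-identityʳ α))
      (++⁺ ⊆-refl (last-block b≤1))
    where
    last-block : b ≤ 1 → highs b ⊆ afterBlock as b
    last-block z≤n       = ⊆-refl
    last-block (s≤s z≤n) = ⊆-refl
  inflate-prefix-⊆ (α ∷ as) (suc i) b b≤1 (s≤s i<as) =
    subst₂ _⊆_ (sym (trans (cong (_++ highs b) (inflate-++ α (prefix as i))) (++-assoc (inflate α) _ _)))
      (cong (expandPrefix (α ∷ as)) (cong (_+ b) (sym (*-suc 2 i))))
      (++⁺ ⊆-refl (e ∷ʳ o₁ ∷ʳ o₂ ∷ʳ inflate-prefix-⊆ as i b b≤1 i<as))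

  module _ {L : ℕ} (new>L : All (L <_) (e ∷ o₁ ∷ o₂ ∷ [])) where

    highs-⊆ : ∀ as i → All (λ α → All (_≤ L) (inflate α)) as → All (L <_) hs →
              hs ⊆ expandPrefix as i → hs ⊆ highs i
    highs-⊆ []       i             _            _    p = ⊆-trans p (minimum _)
    highs-⊆ (α ∷ as) zero          (α≤L ∷ _)    hs>L p = above-⊆-++⁻ʳ α≤L hs>L p
    highs-⊆ (α ∷ as) (suc zero)    (α≤L ∷ _)    hs>L p = above-⊆-++⁻ʳ α≤L hs>L p
    highs-⊆ (α ∷ as) (suc (suc i)) (α≤L ∷ as≤L) hs>L p
      with ⊆-++-split (e ∷ o₁ ∷ o₂ ∷ []) (above-⊆-++⁻ʳ α≤L hs>L p)
    ... | hs₁ , hs₂ , refl , p₁ , p₂ = ++⁺ p₁ (highs-⊆ as i as≤L (All.++⁻ʳ hs₁ hs>L) p₂)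

    below-∉-new : x ≤ L → All (x ≢_) (e ∷ o₁ ∷ o₂ ∷ [])
    below-∉-new x≤L = All.map (λ L<h → <⇒≢ (≤-<-trans x≤L L<h)) new>L

    -- The low part ends inside the inflation of some old block t, so the high part lies in
    -- the new entries of the blocks from 2t on.
    split-prefix : ∀ as i → All (λ α → All (_≤ L) (inflate α)) as → All (_≤ L) ls → All (L <_) hs →
      ls ++ hs ⊆ expandPrefix as i →
      ∃₂ λ t b → i ≡ 2 * t + b × ls ⊆ inflate (prefix as t) × hs ⊆ highs b
    split-prefix {ls} [] i _ _ hs>L p =
      0 , i , refl , ⊆-trans (++⁺ʳ _ ⊆-refl) p , highs-⊆ [] i [] hs>L (⊆-trans (++⁺ˡ ls ⊆-refl) p)
    split-prefix {ls} (α ∷ as) i (α≤L ∷ as≤L) ls≤L hs>L p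
      with ⊆-++-split-below (inflate α) ls α≤L hs>L p
    ... | ls₁ , [] , refl , p₁ , _ =
      0 , i , refl ,
      subst₂ _⊆_ (sym (++-identityʳ ls₁)) (cong inflate (sym (++-identityʳ α))) p₁ ,
      highs-⊆ (α ∷ as) i (α≤L ∷ as≤L) hs>L (⊆-trans (++⁺ˡ ls ⊆-refl) p)
    ... | ls₁ , l ∷ ls₂ , refl , p₁ , p₂ with All.++⁻ʳ ls₁ ls≤L | i
    ...   | l≤L ∷ _     | zero        = ⊥-elim (∷⊈[] (∷-⊆-++⁻ʳ (All.take⁺ 1 (below-∉-new l≤L)) p₂))
    ...   | l≤L ∷ _     | suc zero    = ⊥-elim (∷⊈[] (∷-⊆-++⁻ʳ (below-∉-new l≤L) p₂))
    ...   | l≤L ∷ ls₂≤L | suc (suc i)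
      with split-prefix as i as≤L (l≤L ∷ ls₂≤L) hs>L (∷-⊆-++⁻ʳ (below-∉-new l≤L) p₂)
    ...     | t , b , refl , q₁ , q₂ =
      suc t , b , cong (_+ b) (sym (*-suc 2 t)) ,
      subst (ls₁ ++ l ∷ ls₂ ⊆_) (sym (inflate-++ α (prefix as t))) (++⁺ p₁ q₁) , q₂

module Doubling (s : ℕ) where

  module A′ = Expansion (2 * s + 2) (2 * s + 1) (2 * s + 3)
  module B′ = Expansion (2 * s + 1) (2 * s + 2) (2 * s + 3)

  stepA-expand : ∀ as → stepA s as ≡ A′.expand as
  stepA-expand []       = refl
  stepA-expand (α ∷ as) = cong (λ r → _ ∷ _ ∷ r) (stepA-expand as)

  stepB-expand : ∀ bs → stepB s bs ≡ B′.expand bs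
  stepB-expand []       = refl
  stepB-expand (β ∷ bs) = cong (λ r → _ ∷ _ ∷ r) (stepB-expand bs)

  2s<2s+ : ∀ k → 2 * s < 2 * s + suc k
  2s<2s+ k = m<m+n (2 * s) z<s

  A′-new>2s : All (2 * s <_) (2 * s + 2 ∷ 2 * s + 1 ∷ 2 * s + 3 ∷ [])
  A′-new>2s = 2s<2s+ 1 ∷ 2s<2s+ 0 ∷ 2s<2s+ 2 ∷ []

  B′-new>2s : All (2 * s <_) (2 * s + 1 ∷ 2 * s + 2 ∷ 2 * s + 3 ∷ [])
  B′-new>2s = 2s<2s+ 0 ∷ 2s<2s+ 1 ∷ 2s<2s+ 2 ∷ []

  0<2s+ : ∀ k → 0 < 2 * s + suc k
  0<2s+ k = ≤-<-trans z≤n (2s<2s+ k)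

  length-stepA : ∀ as → length (stepA s as) ≡ 2 * length as
  length-stepA as = trans (cong length (stepA-expand as)) (A′.length-expand as)

  length-stepB : ∀ bs → length (stepB s bs) ≡ 2 * length bs
  length-stepB bs = trans (cong length (stepB-expand bs)) (B′.length-expand bs)

  All-positive-stepA : ∀ {as} → All (0 <_) (concat as) → All (0 <_) (concat (stepA s as))
  All-positive-stepA {as} pos = subst (λ xss → All (0 <_) (concat xss)) (sym (stepA-expand as))
    (A′.All-expand (0<2s+ 1) (0<2s+ 0) (0<2s+ 2) {as} (All.map All-<-inflate (All.concat⁻ pos)))

  All-positive-stepB : ∀ {bs} → All (0 <_) (concat bs) → All (0 <_) (concat (stepB s bs))
  All-positive-stepB {bs} pos = subst (λ xss → All (0 <_) (concat xss)) (sym (stepB-expand bs))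
    (B′.All-expand (0<2s+ 0) (0<2s+ 1) (0<2s+ 2) {bs} (All.map All-<-inflate (All.concat⁻ pos)))

  2s+1<2s+2 : 2 * s + 1 < 2 * s + 2
  2s+1<2s+2 = +-monoʳ-< (2 * s) ≤-refl

  length-common-highs : ∀ a b → AllPairs _<_ hs → hs ⊆ A′.highs a → hs ⊆ B′.highs b → length hs ≤ a + b
  length-common-highs zero          zero    _      (_ ∷ʳ [])   _         = z≤n
  length-common-highs zero          zero    _      (refl ∷ []) (_ ∷ʳ ())
  length-common-highs zero          zero    _      (refl ∷ []) (eq ∷ []) = ⊥-elim (>⇒≢ 2s+1<2s+2 eq)
  length-common-highs zero          (suc b) _      p           _         = ≤-trans (length-mono-≤ p) (s≤s z≤n)
  length-common-highs (suc a)       zero    _      _           q         = ≤-trans (length-mono-≤ q) (s≤s z≤n)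
  length-common-highs (suc zero)    (suc b) sorted p           _         =
    ≤-trans (length-increasing-⊆-inversion (<-asym 2s+1<2s+2) sorted p) (s≤s (s≤s z≤n))
  length-common-highs (suc (suc a)) (suc b) sorted _           q         =
    ≤-trans (length-≤-width (2 * s) 3 sorted
              (All-resp-⊆ q (B′.All-highs (in-range z≤n) (in-range (s≤s z≤n)) (in-range ≤-refl) (suc b))))
            (s≤s (s≤s (≤-trans (s≤s z≤n) (m≤n+m (suc b) a))))
    where
    in-range : ∀ {k} → k ≤ 2 → 2 * s < 2 * s + suc k × 2 * s + suc k ≤ 2 * s + 3
    in-range k≤2 = 2s<2s+ _ , +-monoʳ-≤ (2 * s) (s≤s k≤2)

  common-highs : ∀ {b c} → b ≤ 1 → c ≤ 1 →
    ∃ λ T → AllPairs _<_ T × All (2 * s <_) T × T ⊆ A′.highs b × T ⊆ B′.highs c × length T ≡ b + c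
  common-highs z≤n       z≤n       = [] , [] , [] , minimum _ , minimum _ , refl
  common-highs z≤n       (s≤s z≤n) =
    2 * s + 2 ∷ [] , [] ∷ [] , 2s<2s+ 1 ∷ [] , ⊆-refl , (_ ∷ʳ (refl ∷ (_ ∷ʳ []))) , refl
  common-highs (s≤s z≤n) z≤n       =
    2 * s + 1 ∷ [] , [] ∷ [] , 2s<2s+ 0 ∷ [] , (_ ∷ʳ (refl ∷ (_ ∷ʳ []))) , ⊆-refl , refl
  common-highs (s≤s z≤n) (s≤s z≤n) =
    2 * s + 1 ∷ 2 * s + 3 ∷ [] , ((+-monoʳ-< (2 * s) (s≤s (s≤s z≤n)) ∷ []) ∷ [] ∷ []) ,
    2s<2s+ 0 ∷ 2s<2s+ 2 ∷ [] , (_ ∷ʳ (refl ∷ (refl ∷ []))) , (refl ∷ (_ ∷ʳ (refl ∷ []))) , refl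

  module _ {n : ℕ} {as bs : List (List ℕ)} (|as| : length as ≡ n) (|bs| : length bs ≡ n)
    (as>0 : All (0 <_) (concat as)) (bs>0 : All (0 <_) (concat bs))
    (as≤s : All (_≤ s) (concat as)) (bs≤s : All (_≤ s) (concat bs))
    (lcis : ∀ {i j} → i < n → j < n → LcisIs (prefix as i) (prefix bs j) (i + j + n))
    where

    inflated≤2s : ∀ xss → All (_≤ s) (concat xss) → All (λ α → All (_≤ 2 * s) (inflate α)) xss
    inflated≤2s xss xss≤s = All.map All-≤-inflate (All.concat⁻ {xss = xss} xss≤s)

    upper : ∀ {i j} → i < 2 * n → j < 2 * n → ∀ Z → IsCIS (A′.expandPrefix as i) (B′.expandPrefix bs j) Z →
            length Z ≤ i + j + 2 * n
    upper i< j< Z (Z-linked , Z⊆A , Z⊆B) with split-increasing Z (Linked⇒AllPairs <-trans Z-linked)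
    ... | ls , hs , refl , ls≤2s , hs>2s
      with A′.split-prefix A′-new>2s as _ (inflated≤2s as as≤s) ls≤2s hs>2s Z⊆A
         | B′.split-prefix B′-new>2s bs _ (inflated≤2s bs bs≤s) ls≤2s hs>2s Z⊆B
    ... | t , b , refl , ls⊆A , hs⊆A | u , c , refl , ls⊆B , hs⊆B = begin
      length (ls ++ hs)               ≡⟨ length-++ ls ⟩
      length ls + length hs           ≤⟨ +-mono-≤ (≤-trans (length-deflate ls) (*-monoʳ-≤ 2 low-bound))
                                                    high-bound ⟩
      2 * (t + u + n) + (b + c)       ≡⟨ regroup t u n b c ⟩
      2 * t + b + (2 * u + c) + 2 * n ∎
      where
      open ≤-Reasoning
      sorted : AllPairs _<_ (ls ++ hs)
      sorted = Linked⇒AllPairs <-trans Z-linked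
      low-bound : length (deflate ls) ≤ t + u + n
      low-bound = proj₂ (lcis (2*t+b<2*n⇒t<n i<) (2*t+b<2*n⇒t<n j<)) (deflate ls)
        (deflate-IsCIS (AllPairs-resp-⊆ (++⁺ʳ hs ⊆-refl) sorted) ls⊆A ls⊆B)
      high-bound : length hs ≤ b + c
      high-bound = length-common-highs b c (AllPairs-resp-⊆ (++⁺ˡ ls ⊆-refl) sorted) hs⊆A hs⊆B

    lower : ∀ {i j} → i < 2 * n → j < 2 * n →
            ∃ λ Z → IsCIS (A′.expandPrefix as i) (B′.expandPrefix bs j) Z × length Z ≡ i + j + 2 * n
    lower {i′} {j′} i′< j′< with parity i′ | parity j′
    ... | i , b , b≤1 , refl | j , c , c≤1 , refl
      with lcis (2*t+b<2*n⇒t<n i′<) (2*t+b<2*n⇒t<n j′<) | common-highs b≤1 c≤1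
    ... | (W , (W-linked , W⊆A , W⊆B) , |W|) , _ | T , T-sorted , T>2s , T⊆A , T⊆B , |T| =
      inflate W ++ T , (AllPairs⇒Linked Z-sorted , Z⊆A , Z⊆B) , |Z|
      where
      W-sorted : AllPairs _<_ (inflate W)
      W-sorted = inflate-increasing (All-resp-⊆ W⊆A (All-prefix as as>0)) (Linked⇒AllPairs <-trans W-linked)
      W≤2s : All (_≤ 2 * s) (inflate W)
      W≤2s = All-≤-inflate (All-resp-⊆ W⊆A (All-prefix as as≤s))
      Z-sorted : AllPairs _<_ (inflate W ++ T)
      Z-sorted = AllPairs.++⁺ W-sorted T-sorted (All.map (λ w≤2s → All.map (≤-<-trans w≤2s) T>2s) W≤2s)
      Z⊆A : inflate W ++ T ⊆ A′.expandPrefix as (2 * i + b)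
      Z⊆A = ⊆-trans (++⁺ (inflate⁺ W⊆A) T⊆A)
        (A′.inflate-prefix-⊆ as i b b≤1 (subst (i <_) (sym |as|) (2*t+b<2*n⇒t<n i′<)))
      Z⊆B : inflate W ++ T ⊆ B′.expandPrefix bs (2 * j + c)
      Z⊆B = ⊆-trans (++⁺ (inflate⁺ W⊆B) T⊆B)
        (B′.inflate-prefix-⊆ bs j c c≤1 (subst (j <_) (sym |bs|) (2*t+b<2*n⇒t<n j′<)))
      |Z| : length (inflate W ++ T) ≡ 2 * i + b + (2 * j + c) + 2 * n
      |Z| = begin
        length (inflate W ++ T)          ≡⟨ length-++ (inflate W) ⟩
        length (inflate W) + length T    ≡⟨ cong₂ _+_ (trans (length-inflate W) (cong (2 *_) |W|)) |T| ⟩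
        2 * (i + j + n) + (b + c)        ≡⟨ regroup i j n b c ⟩
        2 * i + b + (2 * j + c) + 2 * n  ∎
        where open ≡-Reasoning

    lcis-step : ∀ {i j} → i < 2 * n → j < 2 * n →
                LcisIs (prefix (stepA s as) i) (prefix (stepB s bs) j) (i + j + 2 * n)
    lcis-step {i} {j} i< j<
      rewrite stepA-expand as | stepB-expand bs | A′.prefix-expand as i | B′.prefix-expand bs j =
      lower i< j< , upper i< j<

blocks-invariant : ∀ k →
  length (αs k) ≡ 2 ^ k × length (βs k) ≡ 2 ^ k × All (0 <_) (A k) × All (0 <_) (B k)
blocks-invariant zero    = refl , refl , z<s ∷ [] , z<s ∷ []
blocks-invariant (suc k) with blocks-invariant k
... | |αs| , |βs| , A>0 , B>0 =
  trans (length-stepA (αs k)) (cong (2 *_) |αs|) , trans (length-stepB (βs k)) (cong (2 *_) |βs|) ,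
  All-positive-stepA {αs k} A>0 , All-positive-stepB {βs k} B>0
  where open Doubling (maxList (A k) ⊔ maxList (B k))

lemma14 : (k i j : ℕ) → i < 2 ^ k → j < 2 ^ k →
    LcisIs (prefixA k i) (prefixB k j) (i + j + 2 ^ k)
lemma14 zero    zero    zero    _       _       =
  (1 ∷ [] , ([-] , refl ∷ [] , refl ∷ []) , refl) , λ _ (_ , Z⊆[1] , _) → length-mono-≤ Z⊆[1]
lemma14 zero    (suc _) _       (s≤s ()) _
lemma14 zero    zero    (suc _) _       (s≤s ())
lemma14 (suc k) i       j       i<      j< with blocks-invariant k
... | |αs| , |βs| , A>0 , B>0 =
  lcis-step {as = αs k} {βs k} |αs| |βs| A>0 B>0 (All-≤-maxList-⊔ˡ (A k) (B k)) (All-≤-maxList-⊔ʳ (A k) (B k))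
    (lemma14 k _ _) i< j<
  where open Doubling (maxList (A k) ⊔ maxList (B k))
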